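{- Let $f\colon\mathbb{B}^n\to\mathbb{B}^n$ be a Boolean network with set of components $V$, let $v\in V$ be such that there is no positive loop at $v$ in $G(f)$, and let $\tilde f$ be obtained from $f$ by eliminating $v$. Then: (i) $S(\tilde f)=S(f)+A(f,v)$, and hence $S(f)\le S(\tilde f)$; (ii) for all $i\in V\setminus\{v\}$, $A(f,i)\le A(\tilde f,i)$; (iii) $S(f)+A(f)\le S(\tilde f)+A(\tilde f)$.
   Context: $\mathbb{B}=\{0,1\}$. A Boolean network is a map $f\colon\mathbb{B}^n\to\mathbb{B}^n$ with set of components $V=\{1,\dots,n\}$. For $x\in\mathbb{B}^n$, $\bar{x}^i$ is $x$ with component $i$ flipped, and $x^{i=a}$ is $x$ with component $i$ set to $a$. The asynchronous dynamics $AD(f)$ is the directed graph on $\mathbb{B}^n$ with a transition $x\to\bar{x}^i$ iff $f_i(x)\neq x_i$. The interaction graph $G(f)$ is the signed multidigraph on $V$ with an edge $j\to i$ of sign $s\in\{ -1,1\}$ iff $s=(f_i(\bar{x}^j)-f_i(x))(\bar{x}^j_j-x_j)$ for some $x$; a positive loop at $v$ is an edge $v\to v$ of sign $+1$. A trap set is a set of states closed under transitions of $AD(f)$; attractors are minimal nonempty trap sets; fixed points are one-state attractors, cyclic attractors are the others. $S(f)$ is the number of fixed points of $f$, $A(f)$ the number of cyclic attractors of $AD(f)$, and $A(f,i)$ the number of cyclic attractors of $AD(f)$ consisting of exactly two states that differ in component $i$. Elimination of $v$: for $a\in\{0,1\}$, $\mathcal{R}^a(x)=(x_1,\dots,x_{v-1},f_v(x^{v=a}),x_{v+1},\dots,x_n)$;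 $\pi\colon\mathbb{B}^n\to\mathbb{B}^{n-1}$ is the projection onto components $V\setminus\{v\}$ (which index $\mathbb{B}^{n-1}$); $\mathcal{S}^a$ is the unique map $\mathbb{B}^{n-1}\to\mathbb{B}^n$ with $\mathcal{S}^a\circ\pi=\mathcal{R}^a$; $\tilde f\colon\mathbb{B}^{n-1}\to\mathbb{B}^{n-1}$ is given for $i\neq v$ by $\tilde f_i(x)=f_i(\mathcal{S}^0(x))\wedge f_i(\mathcal{S}^1(x))$ if $x_i=1$ and $\tilde f_i(x)=f_i(\mathcal{S}^0(x))\vee f_i(\mathcal{S}^1(x))$ if $x_i=0$. -}

module Defs where

open import Data.Bool using (Bool; true; false; not; _∧_; _∨_; if_then_else_)
open import Data.Nat using (ℕ; suc)
open import Data.Fin using (Fin; punchIn)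
open import Data.Vec using (Vec; lookup; insertAt; removeAt; _[_]%=_; _[_]≔_)
open import Data.Integer using (ℤ; _-_; _*_; +_; -[1+_])
open import Data.Product using (Σ; _×_; ∃; ∃-syntax; _,_)
open import Data.Sum using (_⊎_)
open import Relation.Binary.PropositionalEquality using (_≡_; _≢_)

State : ℕ → Set
State n = Vec Bool n

BN : ℕ → Set
BN n = State n → State n

comp : ∀ {n} → BN n → Fin n → State n → Bool
comp f i x = lookup (f x) i

flip : ∀ {n} → Fin n → State n → State n
flip i x = x [ i ]%= not

setTo : ∀ {n} → Fin n → Bool → State n → State n
setTo i a x = x [ i ]≔ a

b2z : Bool → ℤ
b2z false = + 0
b2z true  = + 1

data Sign : Set where
  neg pos : Sign

signZ : Sign → ℤ
signZ neg = -[1+ 0 ]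
signZ pos = + 1

Edge : ∀ {n} → BN n → Fin n → Fin n → Sign → Set
Edge f j i s = ∃[ x ] signZ s ≡
  (b2z (comp f i (flip j x)) - b2z (comp f i x))
    * (b2z (lookup (flip j x) j) - b2z (lookup x j))

PositiveLoop : ∀ {n} → BN n → Fin n → Set
PositiveLoop f v = Edge f v v pos

Trans : ∀ {n} → BN n → State n → State n → Set
Trans f x y = ∃[ i ] (comp f i x ≢ lookup x i × y ≡ flip i x)

StateSet : ℕ → Set
StateSet n = State n → Bool

_∈ₛ_ : ∀ {n} → State n → StateSet n → Set
x ∈ₛ T = T x ≡ true

_⊆ₛ_ : ∀ {n} → StateSet n → StateSet n → Set
T ⊆ₛ T' = ∀ x → x ∈ₛ T → x ∈ₛ T'

_≐_ : ∀ {n} → StateSet n → StateSet n → Set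
T ≐ T' = ∀ x → T x ≡ T' x

Nonempty : ∀ {n} → StateSet n → Set
Nonempty T = ∃[ x ] x ∈ₛ T

IsTrapSet : ∀ {n} → BN n → StateSet n → Set
IsTrapSet f T = ∀ x y → x ∈ₛ T → Trans f x y → y ∈ₛ T

IsAttractor : ∀ {n} → BN n → StateSet n → Set
IsAttractor f T =
  Nonempty T × IsTrapSet f T ×
  (∀ T' → Nonempty T' → IsTrapSet f T' → T' ⊆ₛ T → T ⊆ₛ T')

IsCyclicAttractor : ∀ {n} → BN n → StateSet n → Set
IsCyclicAttractor f T =
  IsAttractor f T × ∃[ x ] ∃[ y ] (x ≢ y × x ∈ₛ T × y ∈ₛ T)

IsTwoStateAttractor : ∀ {n} → BN n → Fin n → StateSet n → Set
IsTwoStateAttractor f i T =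
  IsAttractor f T ×
  ∃[ x ] ∃[ y ] (lookup x i ≢ lookup y i ×
    (∀ z → (z ∈ₛ T → z ≡ x ⊎ z ≡ y) × (z ≡ x ⊎ z ≡ y → z ∈ₛ T)))

IsFixedPoint : ∀ {n} → BN n → State n → Set
IsFixedPoint f x = f x ≡ x

-- Counting: HasSize P _≈_ k  means that, up to the equivalence _≈_,
-- exactly k objects satisfy P (listed without repetition in a vector).

HasSize : {A : Set} → (A → Set) → (A → A → Set) → ℕ → Set
HasSize {A} P _≈_ k =
  Σ (Fin k → A) λ e →
    (∀ a → P (e a)) ×
    (∀ a b → e a ≈ e b → a ≡ b) ×
    (∀ x → P x → ∃[ a ] x ≈ e a)

NumFixedPoints : ∀ {n} → BN n → ℕ → Set
NumFixedPoints f k = HasSize (IsFixedPoint f) _≡_ k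

NumCyclicAttractors : ∀ {n} → BN n → ℕ → Set
NumCyclicAttractors f k = HasSize (IsCyclicAttractor f) _≐_ k

NumTwoStateAttractors : ∀ {n} → BN n → Fin n → ℕ → Set
NumTwoStateAttractors f i k = HasSize (IsTwoStateAttractor f i) _≐_ k

-- Elimination of v (network on n = suc m components, reduced on m).
-- Component j : Fin m of the reduced network is component (punchIn v j)
-- of the original; π = removeAt _ v.

proj : ∀ {m} → Fin (suc m) → State (suc m) → State m
proj v x = removeAt x v

R : ∀ {m} → BN (suc m) → Fin (suc m) → Bool → State (suc m) → State (suc m)
R f v a x = setTo v (comp f v (setTo v a x)) x

-- S^a, the unique map with S^a ∘ π = R^a
S : ∀ {m} → BN (suc m) → Fin (suc m) → Bool → State m → State (suc m)
S f v a y = insertAt y v (comp f v (insertAt y v a))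

eliminate : ∀ {m} → BN (suc m) → Fin (suc m) → BN m
eliminate f v x = Data.Vec.tabulate λ j →
  let i = punchIn v j in
  if lookup x j
    then comp f i (S f v false x) ∧ comp f i (S f v true x)
    else comp f i (S f v false x) ∨ comp f i (S f v true x)

{-# OPTIONS --safe #-}
-- With no positive loop at v, every slice b ↦ f_v(y, b) is either constant, with value c, or
-- negation. In the first case S⁰ y = S¹ y = (y, c) and f̃ behaves at y like f at (y, c); in the
-- second, (y, 0) and (y, 1) can only form a two-state v-attractor. So π maps the fixed points of
-- f together with its two-state v-attractors bijectively onto the fixed points of f̃ (i), and
-- sends two-state i-attractors injectively to two-state attractors of f̃ (ii). For (iii), π(A) is
-- a trap set of f̃ for every attractor A of f and so contains an attractor of f̃; different A give
-- different ones, because a trap set of f containing a state above y contains S⁰ y.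
module Submission where

open import Defs
open import Data.Bool using (Bool; true; false; not; _∧_; _∨_; if_then_else_)
open import Data.Integer using (_-_; _*_)
import Data.Bool.Properties as Boolₚ
open import Data.Empty using (⊥; ⊥-elim)
open import Data.Fin using (Fin; punchIn; punchOut; splitAt; join)
import Data.Fin.Properties as Finₚ
open import Data.Nat using (ℕ; zero; suc; _+_; _≤_; _<_; z≤n; s≤s; s≤s⁻¹)
import Data.Nat.Properties as ℕₚ
open import Data.Product using (_×_; ∃; ∃-syntax; _,_; proj₁; proj₂)
open import Data.Sum using (_⊎_; inj₁; inj₂; [_,_]′)
import Data.Sum as Sum
open import Data.Sum.Relation.Unary.All using (All; inj₁; inj₂)
open import Data.Sum.Relation.Binary.Pointwise using (Pointwise; inj₁; inj₂; ⊎-symmetric; ⊎-transitive)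
open import Data.Vec using ([]; _∷_; lookup; insertAt)
import Data.Vec.Properties as Vecₚ
open import Function using (_∘_)
open import Relation.Binary using (Symmetric; Transitive)
open import Relation.Binary.PropositionalEquality
  using (_≡_; _≢_; refl; sym; trans; cong; cong₂; subst; module ≡-Reasoning)
open import Relation.Nullary using (¬_; Dec; yes; no; does)
open import Relation.Nullary.Decidable using (_×-dec_; _⊎-dec_; ¬?; dec-true)

-- Counting up to an equivalence

module _ {A B : Set} {P : A → Set} {Q : B → Set}
         {_≈₁_ : A → A → Set} {_≈₂_ : B → B → Set} where

  hasSize-⊎ : ∀ {k l} → HasSize P _≈₁_ k → HasSize Q _≈₂_ l →
              HasSize (All P Q) (Pointwise _≈₁_ _≈₂_) (k + l)
  hasSize-⊎ {k} {l} (e₁ , P-e₁ , e₁-inj , e₁-onto) (e₂ , Q-e₂ , e₂-inj , e₂-onto) =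
    e ∘ splitAt k , P-e ∘ splitAt k , e∘split-inj , onto
    where
    e : Fin k ⊎ Fin l → A ⊎ B
    e = Sum.map e₁ e₂

    P-e : ∀ c → All P Q (e c)
    P-e (inj₁ a) = inj₁ (P-e₁ a)
    P-e (inj₂ b) = inj₂ (Q-e₂ b)

    e-inj : ∀ c c' → Pointwise _≈₁_ _≈₂_ (e c) (e c') → c ≡ c'
    e-inj (inj₁ a) (inj₁ a') (inj₁ r) = cong inj₁ (e₁-inj a a' r)
    e-inj (inj₂ b) (inj₂ b') (inj₂ r) = cong inj₂ (e₂-inj b b' r)

    e∘split-inj : ∀ c c' → Pointwise _≈₁_ _≈₂_ (e (splitAt k c)) (e (splitAt k c')) → c ≡ c'
    e∘split-inj c c' r = begin
      c                      ≡⟨ Finₚ.join-splitAt k l c ⟨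
      join k l (splitAt k c)  ≡⟨ cong (join k l) (e-inj (splitAt k c) (splitAt k c') r) ⟩
      join k l (splitAt k c') ≡⟨ Finₚ.join-splitAt k l c' ⟩
      c'                     ∎
      where open ≡-Reasoning

    reindex : ∀ {x} s → Pointwise _≈₁_ _≈₂_ x (e s) → ∃[ c ] Pointwise _≈₁_ _≈₂_ x (e (splitAt k c))
    reindex s r = join k l s , subst (Pointwise _≈₁_ _≈₂_ _ ∘ e) (sym (Finₚ.splitAt-join k l s)) r

    onto : ∀ x → All P Q x → ∃[ c ] Pointwise _≈₁_ _≈₂_ x (e (splitAt k c))
    onto (inj₁ a) (inj₁ p) = reindex (inj₁ (proj₁ (e₁-onto a p))) (inj₁ (proj₂ (e₁-onto a p)))
    onto (inj₂ b) (inj₂ q) = reindex (inj₂ (proj₁ (e₂-onto b q))) (inj₂ (proj₂ (e₂-onto b q)))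

  hasSize-≤ : ∀ {k l} → Symmetric _≈₂_ → Transitive _≈₂_ →
              HasSize P _≈₁_ k → HasSize Q _≈₂_ l → (G : A → B → Set) →
              (∀ x → P x → ∃[ y ] (Q y × G x y)) →
              (∀ {x x' y y'} → P x → P x' → Q y → Q y' → G x y → G x' y' → y ≈₂ y' → x ≈₁ x') →
              k ≤ l
  hasSize-≤ {k} {l} sym₂ trans₂ (e₁ , P-e₁ , e₁-inj , _) (e₂ , _ , _ , e₂-onto) G total reflects =
    Finₚ.injective⇒≤ {f = index} index-inj
    where
    target : ∀ a → ∃[ y ] (Q y × G (e₁ a) y)
    target a = total (e₁ a) (P-e₁ a)

    index-spec : ∀ a → ∃[ b ] proj₁ (target a) ≈₂ e₂ b
    index-spec a = e₂-onto _ (proj₁ (proj₂ (target a)))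

    index : Fin k → Fin l
    index a = proj₁ (index-spec a)

    index-inj : ∀ {a a'} → index a ≡ index a' → a ≡ a'
    index-inj {a} {a'} eq = e₁-inj a a' (reflects (P-e₁ a) (P-e₁ a')
      (proj₁ (proj₂ (target a))) (proj₁ (proj₂ (target a')))
      (proj₂ (proj₂ (target a))) (proj₂ (proj₂ (target a')))
      (trans₂ (proj₂ (index-spec a)) (sym₂ (subst (λ b → _ ≈₂ e₂ b) (sym eq) (proj₂ (index-spec a'))))))

≐-sym : ∀ {n} {T U : StateSet n} → T ≐ U → U ≐ T
≐-sym T≐U x = sym (T≐U x)

≐-trans : ∀ {n} {T U W : StateSet n} → T ≐ U → U ≐ W → T ≐ W
≐-trans T≐U U≐W x = trans (T≐U x) (U≐W x)

_≟ₛ_ : ∀ {n} (x y : State n) → Dec (x ≡ y)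
_≟ₛ_ = Vecₚ.≡-dec Boolₚ._≟_

lookup-ext : ∀ {n} {x y : State n} → (∀ k → lookup x k ≡ lookup y k) → x ≡ y
lookup-ext {x = x} {y} eq =
  trans (sym (Vecₚ.tabulate∘lookup x)) (trans (Vecₚ.tabulate-cong eq) (Vecₚ.tabulate∘lookup y))

lookup-flip : ∀ {n} (i : Fin n) x → lookup (flip i x) i ≡ not (lookup x i)
lookup-flip i x = Vecₚ.lookup∘updateAt i x

lookup-flip-≢ : ∀ {n} {i j : Fin n} x → i ≢ j → lookup (flip j x) i ≡ lookup x i
lookup-flip-≢ {i = i} {j} x i≢j = Vecₚ.lookup∘updateAt′ i j i≢j x

flip-changes : ∀ {n} (i : Fin n) x → lookup (flip i x) i ≢ lookup x i
flip-changes i x eq = Boolₚ.not-¬ refl (trans (sym eq) (lookup-flip i x))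

flip-changes-only : ∀ {n} {i j : Fin n} x → lookup (flip j x) i ≢ lookup x i → i ≡ j
flip-changes-only {i = i} {j} x changed with i Finₚ.≟ j
... | yes i≡j = i≡j
... | no i≢j = ⊥-elim (changed (lookup-flip-≢ x i≢j))

flip-≢ : ∀ {n} (i : Fin n) x → flip i x ≢ x
flip-≢ i x eq = flip-changes i x (cong (λ z → lookup z i) eq)

flip-injectiveˡ : ∀ {n} {i j : Fin n} x → flip i x ≡ flip j x → i ≡ j
flip-injectiveˡ {i = i} x eq =
  flip-changes-only x λ unchanged → flip-changes i x (trans (cong (λ z → lookup z i) eq) unchanged)

flip-involutive : ∀ {n} (i : Fin n) x → flip i (flip i x) ≡ x
flip-involutive i x =
  trans (Vecₚ.updateAt-updateAt-local i x (Boolₚ.not-involutive _)) (Vecₚ.updateAt-id i x)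

module Insertion {m : ℕ} (v : Fin (suc m)) where

  ins : State m → Bool → State (suc m)
  ins y b = insertAt y v b

  lookup-ins : ∀ y b → lookup (ins y b) v ≡ b
  lookup-ins y b = Vecₚ.insertAt-lookup y v b

  lookup-ins-punchIn : ∀ y b j → lookup (ins y b) (punchIn v j) ≡ lookup y j
  lookup-ins-punchIn y b j = Vecₚ.insertAt-punchIn y v b j

  punchIn-cases : ∀ {P : Fin (suc m) → Set} → P v → (∀ j → P (punchIn v j)) → ∀ k → P k
  punchIn-cases {P} Pv Pj k with v Finₚ.≟ k
  ... | yes refl = Pv
  ... | no v≢k = subst P (Finₚ.punchIn-punchOut v≢k) (Pj (punchOut v≢k))

  ins-ext : ∀ {x y : State (suc m)} → lookup x v ≡ lookup y v →
            (∀ j → lookup x (punchIn v j) ≡ lookup y (punchIn v j)) → x ≡ y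
  ins-ext at-v off-v = lookup-ext (punchIn-cases at-v off-v)

  ins-proj : ∀ x → ins (proj v x) (lookup x v) ≡ x
  ins-proj x = Vecₚ.insertAt-removeAt x v

  lookup-proj : ∀ x j → lookup (proj v x) j ≡ lookup x (punchIn v j)
  lookup-proj x j = trans (sym (lookup-ins-punchIn _ (lookup x v) j)) (cong (λ z → lookup z (punchIn v j)) (ins-proj x))

  proj-ins : ∀ y b → proj v (ins y b) ≡ y
  proj-ins y b = Vecₚ.removeAt-insertAt y v b

  flip-ins : ∀ y b → flip v (ins y b) ≡ ins y (not b)
  flip-ins y b = ins-ext
    (trans (lookup-flip v (ins y b)) (trans (cong not (lookup-ins y b)) (sym (lookup-ins y (not b)))))
    λ j → trans (lookup-flip-≢ (ins y b) (Finₚ.punchInᵢ≢i v j))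
                (trans (lookup-ins-punchIn y b j) (sym (lookup-ins-punchIn y (not b) j)))

  flip-punchIn-ins : ∀ y b j → flip (punchIn v j) (ins y b) ≡ ins (flip j y) b
  flip-punchIn-ins y b j = ins-ext
    (trans (lookup-flip-≢ (ins y b) (Finₚ.punchInᵢ≢i v j ∘ sym))
           (trans (lookup-ins y b) (sym (lookup-ins (flip j y) b))))
    λ k → trans (off-v k (k Finₚ.≟ j)) (sym (lookup-ins-punchIn (flip j y) b k))
    where
    off-v : ∀ k → Dec (k ≡ j) → lookup (flip (punchIn v j) (ins y b)) (punchIn v k) ≡ lookup (flip j y) k
    off-v k (yes refl) = trans (lookup-flip (punchIn v k) (ins y b))
      (trans (cong not (lookup-ins-punchIn y b k)) (sym (lookup-flip k y)))
    off-v k (no k≢j) = trans (lookup-flip-≢ (ins y b) (k≢j ∘ Finₚ.punchIn-injective v k j))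
      (trans (lookup-ins-punchIn y b k) (sym (lookup-flip-≢ y k≢j)))

  proj-flip : ∀ x → proj v (flip v x) ≡ proj v x
  proj-flip x = begin
    proj v (flip v x)                             ≡⟨ cong (proj v ∘ flip v) (ins-proj x) ⟨
    proj v (flip v (ins (proj v x) (lookup x v))) ≡⟨ cong (proj v) (flip-ins _ _) ⟩
    proj v (ins (proj v x) (not (lookup x v)))    ≡⟨ proj-ins _ _ ⟩
    proj v x                                      ∎
    where open ≡-Reasoning

  proj-flip-punchIn : ∀ j x → proj v (flip (punchIn v j) x) ≡ flip j (proj v x)
  proj-flip-punchIn j x = begin
    proj v (flip (punchIn v j) x)                             ≡⟨ cong (proj v ∘ flip (punchIn v j)) (ins-proj x) ⟨
    proj v (flip (punchIn v j) (ins (proj v x) (lookup x v))) ≡⟨ cong (proj v) (flip-punchIn-ins _ _ j) ⟩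
    proj v (ins (flip j (proj v x)) (lookup x v))             ≡⟨ proj-ins _ _ ⟩
    flip j (proj v x)                                         ∎
    where open ≡-Reasoning

⟦_⟧ : ∀ {n} {P : State n → Set} → (∀ x → Dec (P x)) → StateSet n
⟦ P? ⟧ x = does (P? x)

∈-⟦⟧⁺ : ∀ {n} {P : State n → Set} (P? : ∀ x → Dec (P x)) {x} → P x → x ∈ₛ ⟦ P? ⟧
∈-⟦⟧⁺ P? {x} = dec-true (P? x)

∈-⟦⟧⁻ : ∀ {n} {P : State n → Set} (P? : ∀ x → Dec (P x)) {x} → x ∈ₛ ⟦ P? ⟧ → P x
∈-⟦⟧⁻ P? {x} with P? x
... | yes p = λ _ → p

singleton : ∀ {n} → State n → StateSet n
singleton a = ⟦ _≟ₛ a ⟧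

∈-singleton : ∀ {n} (a : State n) → a ∈ₛ singleton a
∈-singleton a = ∈-⟦⟧⁺ (_≟ₛ a) refl

∈-singleton⁻ : ∀ {n} {a z : State n} → z ∈ₛ singleton a → z ≡ a
∈-singleton⁻ {a = a} = ∈-⟦⟧⁻ (_≟ₛ a)

pair? : ∀ {n} (a b z : State n) → Dec (z ≡ a ⊎ z ≡ b)
pair? a b z = (z ≟ₛ a) ⊎-dec (z ≟ₛ b)

pair : ∀ {n} → State n → State n → StateSet n
pair a b = ⟦ pair? a b ⟧

∈-pair⁺ : ∀ {n} {a b z : State n} → z ≡ a ⊎ z ≡ b → z ∈ₛ pair a b
∈-pair⁺ {a = a} {b} = ∈-⟦⟧⁺ (pair? a b)

∈-pairˡ : ∀ {n} (a b : State n) → a ∈ₛ pair a b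
∈-pairˡ a b = ∈-pair⁺ {a = a} {b} (inj₁ refl)

∈-pair⁻ : ∀ {n} {a b z : State n} → z ∈ₛ pair a b → z ≡ a ⊎ z ≡ b
∈-pair⁻ {a = a} {b} = ∈-⟦⟧⁻ (pair? a b)

singleton-⊆ : ∀ {n} {a : State n} {T} → a ∈ₛ T → singleton a ⊆ₛ T
singleton-⊆ {a = a} a∈T z z∈ with refl ← ∈-singleton⁻ {a = a} {z} z∈ = a∈T

⊆-antisym : ∀ {n} {T U : StateSet n} → T ⊆ₛ U → U ⊆ₛ T → T ≐ U
⊆-antisym {T = T} {U} T⊆U U⊆T x with T x in Tx | U x in Ux
... | true  | true  = refl
... | false | false = refl
... | true  | false = trans (sym (T⊆U x Tx)) Ux
... | false | true  = trans (sym Tx) (U⊆T x Ux)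

-- Attractors of an arbitrary network

Stable : ∀ {n} → BN n → State n → Set
Stable g x = ∀ k → comp g k x ≡ lookup x k

OnlyUnstableAt : ∀ {n} → BN n → Fin n → State n → Set
OnlyUnstableAt g i x = (∀ k → k ≢ i → comp g k x ≡ lookup x k) × comp g i x ≢ lookup x i

module _ {n : ℕ} (g : BN n) where

  fixedPoint⇒stable : ∀ {x} → IsFixedPoint g x → Stable g x
  fixedPoint⇒stable gx≡x k = cong (λ z → lookup z k) gx≡x

  stable⇒fixedPoint : ∀ {x} → Stable g x → IsFixedPoint g x
  stable⇒fixedPoint = lookup-ext

  singleton-trap : ∀ {x} → Stable g x → IsTrapSet g (singleton x)
  singleton-trap {x} stable w z w∈ (k , unstable , _)
    with refl ← ∈-singleton⁻ {a = x} {w} w∈ = ⊥-elim (unstable (stable k))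

  fixedPoint⇒attractor : ∀ {x} → IsFixedPoint g x → IsAttractor g (singleton x)
  fixedPoint⇒attractor {x} gx≡x =
    (x , ∈-singleton x) , singleton-trap (fixedPoint⇒stable gx≡x) , minimal
    where
    minimal : ∀ T → Nonempty T → IsTrapSet g T → T ⊆ₛ singleton x → singleton x ⊆ₛ T
    minimal T (w , w∈T) _ T⊆x z z∈x
      with refl ← ∈-singleton⁻ {a = x} {z} z∈x | refl ← ∈-singleton⁻ {a = x} {w} (T⊆x w w∈T) = w∈T

  -- The intersection of two attractors with a common state is a nonempty trap set.
  attractors-meeting-≐ : ∀ {T U x} → IsAttractor g T → IsAttractor g U → x ∈ₛ T → x ∈ₛ U → T ≐ U
  attractors-meeting-≐ {T} {U} {x} (_ , T-trap , T-min) (_ , U-trap , U-min) x∈T x∈U =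
    ⊆-antisym (λ z z∈T → proj₂ (∧-∈ (T⊆T∩U z z∈T))) (λ z z∈U → proj₁ (∧-∈ (U⊆T∩U z z∈U)))
    where
    T∩U : StateSet n
    T∩U z = T z ∧ U z
    ∧-∈ : ∀ {z} → z ∈ₛ T∩U → z ∈ₛ T × z ∈ₛ U
    ∧-∈ z∈ = Boolₚ.∧-conicalˡ _ _ z∈ , Boolₚ.∧-conicalʳ _ _ z∈
    ∈-∧ : ∀ {z} → z ∈ₛ T → z ∈ₛ U → z ∈ₛ T∩U
    ∈-∧ = cong₂ _∧_
    T∩U-trap : IsTrapSet g T∩U
    T∩U-trap w z w∈ w→z = ∈-∧ (T-trap w z (proj₁ (∧-∈ w∈)) w→z) (U-trap w z (proj₂ (∧-∈ w∈)) w→z)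
    T⊆T∩U : T ⊆ₛ T∩U
    T⊆T∩U = T-min T∩U (x , ∈-∧ x∈T x∈U) T∩U-trap (λ z → proj₁ ∘ ∧-∈)
    U⊆T∩U : U ⊆ₛ T∩U
    U⊆T∩U = U-min T∩U (x , ∈-∧ x∈T x∈U) T∩U-trap (λ z → proj₂ ∘ ∧-∈)

  onlyUnstableAt-successor : ∀ {i w z} → OnlyUnstableAt g i w → Trans g w z → z ≡ flip i w
  onlyUnstableAt-successor {i} (stable , _) (k , unstable , z≡) with k Finₚ.≟ i
  ... | yes refl = z≡
  ... | no k≢i = ⊥-elim (unstable (stable k k≢i))

  onlyUnstableAt⇒twoStateAttractor : ∀ {i x} → OnlyUnstableAt g i x → OnlyUnstableAt g i (flip i x) →
                                     IsTwoStateAttractor g i (pair x (flip i x))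
  onlyUnstableAt⇒twoStateAttractor {i} {x} x-only y-only =
    ((x , ∈-pairˡ x y) , trap , minimal) ,
    x , y , flip-changes i x ∘ sym , λ z → ∈-pair⁻ , ∈-pair⁺
    where
    y : State n
    y = flip i x
    x→y : Trans g x y
    x→y = i , proj₂ x-only , refl
    y→x : Trans g y x
    y→x = i , proj₂ y-only , sym (flip-involutive i x)
    trap : IsTrapSet g (pair x y)
    trap w z w∈ w→z with ∈-pair⁻ {z = w} w∈
    ... | inj₁ refl = ∈-pair⁺ (inj₂ (onlyUnstableAt-successor x-only w→z))
    ... | inj₂ refl = ∈-pair⁺ (inj₁ (trans (onlyUnstableAt-successor y-only w→z) (flip-involutive i x)))
    minimal : ∀ T → Nonempty T → IsTrapSet g T → T ⊆ₛ pair x y → pair x y ⊆ₛ T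
    minimal T (w , w∈T) T-trap T⊆ z z∈ with ∈-pair⁻ {z = z} z∈ | ∈-pair⁻ {z = w} (T⊆ w w∈T)
    ... | inj₁ refl | inj₁ refl = w∈T
    ... | inj₁ refl | inj₂ refl = T-trap y x w∈T y→x
    ... | inj₂ refl | inj₁ refl = T-trap x y w∈T x→y
    ... | inj₂ refl | inj₂ refl = w∈T

  pairAttractor-structure : ∀ {T i p q} → IsAttractor g T → p ∈ₛ T → q ∈ₛ T →
                            (∀ z → z ∈ₛ T → z ≡ p ⊎ z ≡ q) → lookup p i ≢ lookup q i →
                            q ≡ flip i p × OnlyUnstableAt g i p
  pairAttractor-structure {T} {i} {p} {q} (_ , T-trap , T-min) p∈T q∈T T⊆pq pᵢ≢qᵢ =
    q≡flip , others-stable , subst (λ l → comp g l p ≢ lookup p l) (sym i≡k) (proj₂ unstable)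
    where
    p-unstable : ¬ Stable g p
    p-unstable stable = pᵢ≢qᵢ (cong (λ z → lookup z i) (sym q≡p))
      where
      q≡p : q ≡ p
      q≡p = ∈-singleton⁻ {a = p}
        (T-min (singleton p) (p , ∈-singleton p) (singleton-trap stable) (singleton-⊆ p∈T) q q∈T)

    successor : ∀ k → comp g k p ≢ lookup p k → flip k p ≡ q
    successor k unstable-k with T⊆pq (flip k p) (T-trap p (flip k p) p∈T (k , unstable-k , refl))
    ... | inj₁ flip≡p = ⊥-elim (flip-≢ k p flip≡p)
    ... | inj₂ flip≡q = flip≡q

    unstable : ∃[ k ] comp g k p ≢ lookup p k
    unstable = Finₚ.¬∀⟶∃¬ n _ (λ k → comp g k p Boolₚ.≟ lookup p k) p-unstable

    i≡k : i ≡ proj₁ unstable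
    i≡k = flip-changes-only p λ unchanged →
      pᵢ≢qᵢ (sym (trans (cong (λ z → lookup z i) (sym (successor _ (proj₂ unstable)))) unchanged))

    q≡flip : q ≡ flip i p
    q≡flip = trans (sym (successor _ (proj₂ unstable))) (cong (λ l → flip l p) (sym i≡k))

    others-stable : ∀ k → k ≢ i → comp g k p ≡ lookup p k
    others-stable k k≢i with comp g k p Boolₚ.≟ lookup p k
    ... | yes stable-k = stable-k
    ... | no unstable-k = ⊥-elim (k≢i (flip-injectiveˡ p (trans (successor k unstable-k) q≡flip)))

  twoStateAttractor-flipPair : ∀ {i T} → IsTwoStateAttractor g i T →
    ∃[ x ] ((∀ z → z ∈ₛ T → z ≡ x ⊎ z ≡ flip i x) × x ∈ₛ T × flip i x ∈ₛ T ×
            OnlyUnstableAt g i x × OnlyUnstableAt g i (flip i x))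
  twoStateAttractor-flipPair {i} {T} (T-attr , x , y , xᵢ≢yᵢ , T≡xy) =
    x , subst (λ w → ∀ z → z ∈ₛ T → z ≡ x ⊎ z ≡ w) y≡ (proj₁ ∘ T≡xy) , x∈T , subst (_∈ₛ T) y≡ y∈T ,
    proj₂ from-x , subst (OnlyUnstableAt g i) y≡ (proj₂ from-y)
    where
    x∈T : x ∈ₛ T
    x∈T = proj₂ (T≡xy x) (inj₁ refl)
    y∈T : y ∈ₛ T
    y∈T = proj₂ (T≡xy y) (inj₂ refl)
    from-x : y ≡ flip i x × OnlyUnstableAt g i x
    from-x = pairAttractor-structure T-attr x∈T y∈T (proj₁ ∘ T≡xy) xᵢ≢yᵢ
    from-y : x ≡ flip i y × OnlyUnstableAt g i y
    from-y = pairAttractor-structure T-attr y∈T x∈T (λ z → Sum.swap ∘ proj₁ (T≡xy z)) (xᵢ≢yᵢ ∘ sym)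
    y≡ : y ≡ flip i x
    y≡ = proj₁ from-x

  twoStateAttractor-onlyUnstableAt : ∀ {i T z} → IsTwoStateAttractor g i T → z ∈ₛ T →
                                     OnlyUnstableAt g i z × flip i z ∈ₛ T
  twoStateAttractor-onlyUnstableAt {i} {T} {z} T-attr z∈T
    with twoStateAttractor-flipPair T-attr
  ... | x , T⊆ , x∈T , flip∈T , x-only , flip-only with T⊆ z z∈T
  ... | inj₁ refl = x-only , flip∈T
  ... | inj₂ refl = flip-only , subst (_∈ₛ T) (sym (flip-involutive i x)) x∈T

  twoStateAttractor-onlyUnstableAt-flip : ∀ {i T z} → IsTwoStateAttractor g i T → z ∈ₛ T →
                                          OnlyUnstableAt g i (flip i z)
  twoStateAttractor-onlyUnstableAt-flip T-attr z∈T =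
    proj₁ (twoStateAttractor-onlyUnstableAt T-attr (proj₂ (twoStateAttractor-onlyUnstableAt T-attr z∈T)))

  twoStateAttractor-members : ∀ {i T a b} → IsTwoStateAttractor g i T → a ∈ₛ T → b ∈ₛ T →
                              a ≡ b ⊎ a ≡ flip i b
  twoStateAttractor-members {i} {T} {a} {b} T-attr a∈T b∈T
    with twoStateAttractor-flipPair T-attr
  ... | x , T⊆ , _ with T⊆ a a∈T | T⊆ b b∈T
  ... | inj₁ refl | inj₁ refl = inj₁ refl
  ... | inj₂ refl | inj₂ refl = inj₁ refl
  ... | inj₁ refl | inj₂ refl = inj₂ (sym (flip-involutive i x))
  ... | inj₂ refl | inj₁ refl = inj₂ refl

-- Finiteness of the state space

size : ∀ n → StateSet n → ℕ
size zero    T = if T [] then 1 else 0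
size (suc n) T = size n (T ∘ (true ∷_)) + size n (T ∘ (false ∷_))

size-mono : ∀ n {T U : StateSet n} → T ⊆ₛ U → size n T ≤ size n U
size-mono zero {T} {U} T⊆U with T [] in T[] | U [] in U[]
... | false | _     = z≤n
... | true  | true  = ℕₚ.≤-refl
... | true  | false = ⊥-elim (Boolₚ.not-¬ refl (trans (sym (T⊆U [] T[])) U[]))
size-mono (suc n) T⊆U =
  ℕₚ.+-mono-≤ (size-mono n (T⊆U ∘ (true ∷_))) (size-mono n (T⊆U ∘ (false ∷_)))

size-< : ∀ n {T U : StateSet n} → T ⊆ₛ U → ∀ z → T z ≡ false → z ∈ₛ U → size n T < size n U
size-< zero    T⊆U [] T[] U[] rewrite T[] | U[] = s≤s z≤n
size-< (suc n) T⊆U (true ∷ z) z∉T z∈U =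
  ℕₚ.+-mono-<-≤ (size-< n (T⊆U ∘ (true ∷_)) z z∉T z∈U) (size-mono n (T⊆U ∘ (false ∷_)))
size-< (suc n) T⊆U (false ∷ z) z∉T z∈U =
  ℕₚ.+-mono-≤-< (size-mono n (T⊆U ∘ (true ∷_))) (size-< n (T⊆U ∘ (false ∷_)) z z∉T z∈U)

any?ₛ : ∀ {n} {P : State n → Set} → (∀ x → Dec (P x)) → Dec (∃ P)
any?ₛ {zero} P? with P? []
... | yes p = yes ([] , p)
... | no ¬p = no λ { ([] , p) → ¬p p }
any?ₛ {suc n} P? with any?ₛ (P? ∘ (true ∷_)) | any?ₛ (P? ∘ (false ∷_))
... | yes (y , p) | _           = yes (true ∷ y , p)
... | no _        | yes (y , p) = yes (false ∷ y , p)
... | no ¬p₁      | no ¬p₀      = no λ { (true ∷ y , p) → ¬p₁ (y , p) ; (false ∷ y , p) → ¬p₀ (y , p) }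

transition? : ∀ {n} (g : BN n) x y → Dec (Trans g x y)
transition? g x y = Finₚ.any? λ i → ¬? (comp g i x Boolₚ.≟ lookup x i) ×-dec (y ≟ₛ flip i x)

module Reachability {n : ℕ} (g : BN n) where

  Step : StateSet n → State n → Set
  Step U z = z ∈ₛ U ⊎ ∃[ w ] (w ∈ₛ U × Trans g w z)

  step? : ∀ U z → Dec (Step U z)
  step? U z = (U z Boolₚ.≟ true) ⊎-dec any?ₛ (λ w → (U w Boolₚ.≟ true) ×-dec transition? g w z)

  step : StateSet n → StateSet n
  step U = ⟦ step? U ⟧

  ⊆-step : ∀ {U} → U ⊆ₛ step U
  ⊆-step {U} z z∈U = ∈-⟦⟧⁺ (step? U) (inj₁ z∈U)

  step-successor : ∀ {U w z} → w ∈ₛ U → Trans g w z → z ∈ₛ step U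
  step-successor {U} {w} w∈U w→z = ∈-⟦⟧⁺ (step? U) (inj₂ (w , w∈U , w→z))

  step-⊆-trap : ∀ {U T} → IsTrapSet g T → U ⊆ₛ T → step U ⊆ₛ T
  step-⊆-trap {U} T-trap U⊆T z z∈ with ∈-⟦⟧⁻ (step? U) {z} z∈
  ... | inj₁ z∈U = U⊆T z z∈U
  ... | inj₂ (w , w∈U , w→z) = T-trap w z (U⊆T w w∈U) w→z

  step-trap : ∀ {U} → IsTrapSet g U → IsTrapSet g (step U)
  step-trap U-trap w z w∈ w→z = step-successor (step-⊆-trap U-trap (λ _ w∈ → w∈) w w∈) w→z

  step-grows-or-trap : ∀ U → IsTrapSet g U ⊎ ∃[ z ] (U z ≡ false × z ∈ₛ step U)
  step-grows-or-trap U with any?ₛ (λ z → (U z Boolₚ.≟ false) ×-dec (step U z Boolₚ.≟ true))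
  ... | yes grows = inj₂ grows
  ... | no ¬grows = inj₁ λ w z w∈U w→z →
    Boolₚ.¬-not (λ z∉U → ¬grows (z , z∉U , step-successor w∈U w→z))

  iterate : ℕ → StateSet n → StateSet n
  iterate zero    U = U
  iterate (suc k) U = step (iterate k U)

  -- Each step that does not yield a trap set adds a state.
  iterate-trap-or-large : ∀ k U → IsTrapSet g (iterate k U) ⊎ k ≤ size n (iterate k U)
  iterate-trap-or-large zero U = inj₂ z≤n
  iterate-trap-or-large (suc k) U with iterate-trap-or-large k U | step-grows-or-trap (iterate k U)
  ... | inj₁ trap | _ = inj₁ (step-trap trap)
  ... | inj₂ _    | inj₁ trap = inj₁ (step-trap trap)
  ... | inj₂ k≤   | inj₂ (z , z∉ , z∈) = inj₂ (ℕₚ.≤-<-trans k≤ (size-< n ⊆-step z z∉ z∈))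

  ⊆-iterate : ∀ k {U} → U ⊆ₛ iterate k U
  ⊆-iterate zero    z z∈U = z∈U
  ⊆-iterate (suc k) z z∈U = ⊆-step z (⊆-iterate k z z∈U)

  iterate-⊆-trap : ∀ k {U T} → IsTrapSet g T → U ⊆ₛ T → iterate k U ⊆ₛ T
  iterate-⊆-trap zero    T-trap U⊆T = U⊆T
  iterate-⊆-trap (suc k) T-trap U⊆T = step-⊆-trap T-trap (iterate-⊆-trap k T-trap U⊆T)

  steps : ℕ
  steps = suc (size n (λ _ → true))

  reach : State n → StateSet n
  reach x = iterate steps (singleton x)

  reach-self : ∀ x → x ∈ₛ reach x
  reach-self x = ⊆-iterate steps x (∈-singleton x)

  reach-trap : ∀ x → IsTrapSet g (reach x)
  reach-trap x with iterate-trap-or-large steps (singleton x)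
  ... | inj₁ trap = trap
  ... | inj₂ large = ⊥-elim (ℕₚ.<⇒≱ large (size-mono n (λ _ _ → refl)))

  reach-least : ∀ {T x} → IsTrapSet g T → x ∈ₛ T → reach x ⊆ₛ T
  reach-least T-trap x∈T = iterate-⊆-trap steps T-trap (singleton-⊆ x∈T)

  -- A state of reach x from which x is unreachable has a strictly smaller reachable set.
  attractor-⊆-reach : ∀ k x → size n (reach x) < k → ∃[ A ] (IsAttractor g A × A ⊆ₛ reach x)
  attractor-⊆-reach (suc k) x bound
    with any?ₛ (λ z → (reach x z Boolₚ.≟ true) ×-dec (reach z x Boolₚ.≟ false))
  ... | no ¬escape = reach x , ((x , reach-self x) , reach-trap x , minimal) , λ _ z∈ → z∈
    where
    returns : ∀ {z} → z ∈ₛ reach x → x ∈ₛ reach z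
    returns z∈ = Boolₚ.¬-not λ x∉ → ¬escape (_ , z∈ , x∉)
    minimal : ∀ T → Nonempty T → IsTrapSet g T → T ⊆ₛ reach x → reach x ⊆ₛ T
    minimal T (w , w∈T) T-trap T⊆ = reach-least T-trap (reach-least T-trap w∈T x (returns (T⊆ w w∈T)))
  ... | yes (z , z∈ , x∉)
    with attractor-⊆-reach k z (ℕₚ.<-≤-trans (size-< n (reach-least (reach-trap x) z∈) x x∉ (reach-self x))
                                            (s≤s⁻¹ bound))
  ... | A , A-attr , A⊆ = A , A-attr , λ u u∈ → reach-least (reach-trap x) z∈ u (A⊆ u u∈)

  attractor-in-trap : ∀ {T} → Nonempty T → IsTrapSet g T → ∃[ A ] (IsAttractor g A × A ⊆ₛ T)
  attractor-in-trap (x , x∈T) T-trap with attractor-⊆-reach _ x (ℕₚ.n<1+n _)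
  ... | A , A-attr , A⊆ = A , A-attr , λ z z∈ → reach-least T-trap x∈T z (A⊆ z z∈)

  attractor-fixedPoint-or-cyclic : ∀ {A} → IsAttractor g A →
                                   (∃[ x ] (IsFixedPoint g x × x ∈ₛ A)) ⊎ IsCyclicAttractor g A
  attractor-fixedPoint-or-cyclic {A} A-attr@((x , x∈A) , A-trap , _)
    with any?ₛ (λ z → (A z Boolₚ.≟ true) ×-dec ¬? (z ≟ₛ x))
  ... | yes (z , z∈A , z≢x) = inj₂ (A-attr , x , z , z≢x ∘ sym , x∈A , z∈A)
  ... | no ¬other = inj₁ (x , stable⇒fixedPoint g stable , x∈A)
    where
    stable : Stable g x
    stable k with comp g k x Boolₚ.≟ lookup x k
    ... | yes stable-k = stable-k
    ... | no unstable-k = ⊥-elim (¬other (flip k x , A-trap x (flip k x) x∈A (k , unstable-k , refl) , flip-≢ k x))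

-- Fixed points and cyclic attractors as one family

Nontrivial : ∀ {n} → StateSet n → Set
Nontrivial T = ∃[ x ] ∃[ y ] (x ≢ y × x ∈ₛ T × y ∈ₛ T)

statesOf : ∀ {n} → State n ⊎ StateSet n → StateSet n
statesOf = [ singleton , (λ T → T) ]′

FixedPointOrCyclic : ∀ {n} → BN n → State n ⊎ StateSet n → Set
FixedPointOrCyclic g = All (IsFixedPoint g) (IsCyclicAttractor g)

FixedPointOrTwoState : ∀ {n} → BN n → Fin n → State n ⊎ StateSet n → Set
FixedPointOrTwoState g i = All (IsFixedPoint g) (IsTwoStateAttractor g i)

Pointwise⇒statesOf-≐ : ∀ {n} {t t' : State n ⊎ StateSet n} → Pointwise _≡_ _≐_ t t' →
                       statesOf t ≐ statesOf t'
Pointwise⇒statesOf-≐ (inj₁ refl) _ = refl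
Pointwise⇒statesOf-≐ (inj₂ T≐T') = T≐T'

twoStateAttractor-nontrivial : ∀ {n} {g : BN n} {i T} → IsTwoStateAttractor g i T → Nontrivial T
twoStateAttractor-nontrivial {i = i} (_ , x , y , xᵢ≢yᵢ , T≡xy) =
  x , y , xᵢ≢yᵢ ∘ cong (λ z → lookup z i) , proj₂ (T≡xy x) (inj₁ refl) , proj₂ (T≡xy y) (inj₂ refl)

statesOf-attractor : ∀ {n} {g : BN n} {K : StateSet n → Set} → (∀ {T} → K T → IsAttractor g T) →
                     ∀ {t} → All (IsFixedPoint g) K t → IsAttractor g (statesOf t)
statesOf-attractor {g = g} K-attractor (inj₁ fix) = fixedPoint⇒attractor g fix
statesOf-attractor K-attractor (inj₂ KT) = K-attractor KT

module _ {n : ℕ} {P : State n → Set} {K : StateSet n → Set} (K-nontrivial : ∀ {T} → K T → Nontrivial T) where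

  singleton-≐-nontrivial : ∀ {x T} → K T → singleton x ≐ T → ⊥
  singleton-≐-nontrivial {x} {T} KT x≐T with K-nontrivial KT
  ... | a , b , a≢b , a∈T , b∈T = a≢b (trans (at a a∈T) (sym (at b b∈T)))
    where
    at : ∀ z → z ∈ₛ T → z ≡ x
    at z z∈T = ∈-singleton⁻ {a = x} {z} (trans (x≐T z) z∈T)

  statesOf-injective : ∀ {t t'} → All P K t → All P K t' → statesOf t ≐ statesOf t' →
                       Pointwise _≡_ _≐_ t t'
  statesOf-injective {inj₁ x} {inj₁ x'} _ _ x≐x' =
    inj₁ (∈-singleton⁻ {a = x'} (trans (sym (x≐x' x)) (∈-singleton x)))
  statesOf-injective {inj₂ T} {inj₂ T'} _ _ T≐T' = inj₂ T≐T'
  statesOf-injective {inj₁ x} {inj₂ T'} _ (inj₂ KT') x≐T' = ⊥-elim (singleton-≐-nontrivial KT' x≐T')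
  statesOf-injective {inj₂ T} {inj₁ x'} (inj₂ KT) _ T≐x' = ⊥-elim (singleton-≐-nontrivial KT (≐-sym T≐x'))

-- Elimination of a component

merge : Bool → Bool → Bool → Bool
merge c a b = if c then a ∧ b else a ∨ b

merge-≡⁺ : ∀ {c a b} → a ≡ c → b ≡ c → merge c a b ≡ c
merge-≡⁺ {false} refl refl = refl
merge-≡⁺ {true}  refl refl = refl

merge-≡⁻ : ∀ c a b → merge c a b ≡ c → a ≡ c × b ≡ c
merge-≡⁻ false false false _ = refl , refl
merge-≡⁻ true  true  true  _ = refl , refl
merge-≡⁻ false false true  ()
merge-≡⁻ false true  _     ()
merge-≡⁻ true  false _     ()
merge-≡⁻ true  true  false ()

merge-idem : ∀ c a → merge c a a ≡ a
merge-idem false = Boolₚ.∨-idem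
merge-idem true  = Boolₚ.∧-idem

both-values : ∀ {P : Bool → Set} c → P c → P (not c) → ∀ b → P b
both-values false P-c P-¬c false = P-c
both-values false P-c P-¬c true  = P-¬c
both-values true  P-c P-¬c false = P-¬c
both-values true  P-c P-¬c true  = P-c

module Elimination {m : ℕ} (f : BN (suc m)) (v : Fin (suc m)) where

  open Insertion v

  f̃ : BN m
  f̃ = eliminate f v

  fᵥ : State m → Bool → Bool
  fᵥ y b = comp f v (ins y b)

  comp-f̃ : ∀ y j → comp f̃ j y ≡
           merge (lookup y j) (comp f (punchIn v j) (S f v false y)) (comp f (punchIn v j) (S f v true y))
  comp-f̃ y j = Vecₚ.lookup∘tabulate _ j

  eliminate-stable⁺ : ∀ {y j} → (∀ a → comp f (punchIn v j) (S f v a y) ≡ lookup y j) →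
                      comp f̃ j y ≡ lookup y j
  eliminate-stable⁺ {y} {j} stable = trans (comp-f̃ y j) (merge-≡⁺ (stable false) (stable true))

  eliminate-stable⁻ : ∀ {y j} → comp f̃ j y ≡ lookup y j →
                      ∀ a → comp f (punchIn v j) (S f v a y) ≡ lookup y j
  eliminate-stable⁻ {y} {j} stable = both-values false (proj₁ stable-S) (proj₂ stable-S)
    where
    stable-S : comp f (punchIn v j) (S f v false y) ≡ lookup y j × comp f (punchIn v j) (S f v true y) ≡ lookup y j
    stable-S = merge-≡⁻ _ _ _ (trans (sym (comp-f̃ y j)) stable)

  eliminate-unstable : ∀ {y j} → comp f̃ j y ≢ lookup y j →
                       ∃[ a ] comp f (punchIn v j) (S f v a y) ≢ lookup y j
  eliminate-unstable {y} {j} unstable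
    with comp f (punchIn v j) (S f v false y) Boolₚ.≟ lookup y j
       | comp f (punchIn v j) (S f v true y) Boolₚ.≟ lookup y j
  ... | no unstable₀ | _            = false , unstable₀
  ... | yes _        | no unstable₁ = true , unstable₁
  ... | yes stable₀  | yes stable₁  = ⊥-elim (unstable (eliminate-stable⁺ (both-values false stable₀ stable₁)))

  Oscillates : State m → Set
  Oscillates y = fᵥ y false ≡ true × fᵥ y true ≡ false

  oscillates-not : ∀ {y} → Oscillates y → ∀ b → fᵥ y (not b) ≡ b
  oscillates-not (_ , fᵥ₁) false = fᵥ₁
  oscillates-not (fᵥ₀ , _) true  = fᵥ₀

  oscillates-unstable : ∀ {y} → Oscillates y → ∀ b → fᵥ y b ≢ b
  oscillates-unstable (fᵥ₀ , _) false = Boolₚ.not-¬ fᵥ₀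
  oscillates-unstable (_ , fᵥ₁) true  = Boolₚ.not-¬ fᵥ₁

  onlyUnstableAt-v⁻ : ∀ {y} → (∀ b → OnlyUnstableAt f v (ins y b)) → Oscillates y × IsFixedPoint f̃ y
  onlyUnstableAt-v⁻ {y} only =
    (Boolₚ.¬-not (unstable false) , Boolₚ.¬-not (unstable true)) ,
    stable⇒fixedPoint f̃ λ j → eliminate-stable⁺ λ a → stable (fᵥ y a) j
    where
    unstable : ∀ b → fᵥ y b ≢ b
    unstable b fᵥ≡b = proj₂ (only b) (trans fᵥ≡b (sym (lookup-ins y b)))
    stable : ∀ b j → comp f (punchIn v j) (ins y b) ≡ lookup y j
    stable b j = trans (proj₁ (only b) (punchIn v j) (Finₚ.punchInᵢ≢i v j)) (lookup-ins-punchIn y b j)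

  onlyUnstableAt-v⁺ : ∀ {y} → Oscillates y → IsFixedPoint f̃ y → ∀ b → OnlyUnstableAt f v (ins y b)
  onlyUnstableAt-v⁺ {y} osc fix b =
    punchIn-cases (λ v≢v → ⊥-elim (v≢v refl)) (λ j _ → trans (stable j) (sym (lookup-ins-punchIn y b j))) ,
    λ unstable → oscillates-unstable osc b (trans unstable (lookup-ins y b))
    where
    stable : ∀ j → comp f (punchIn v j) (ins y b) ≡ lookup y j
    stable j = subst (λ c → comp f (punchIn v j) (ins y c) ≡ lookup y j) (oscillates-not osc b)
                 (eliminate-stable⁻ (fixedPoint⇒stable f̃ fix j) (not b))

  image : StateSet (suc m) → StateSet m
  image T y = T (ins y false) ∨ T (ins y true)

  ∈-image⁺ : ∀ T {y} c → ins y c ∈ₛ T → y ∈ₛ image T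
  ∈-image⁺ T {y} false ins∈T = cong (_∨ T (ins y true)) ins∈T
  ∈-image⁺ T {y} true ins∈T = trans (cong (T (ins y false) ∨_) ins∈T) (Boolₚ.∨-zeroʳ _)

  ∈-image⁻ : ∀ T {y} → y ∈ₛ image T → ∃[ c ] ins y c ∈ₛ T
  ∈-image⁻ T {y} y∈ with T (ins y false) in ins₀∈T
  ... | true  = false , ins₀∈T
  ... | false = true , y∈

  proj-∈-image : ∀ T {x} → x ∈ₛ T → proj v x ∈ₛ image T
  proj-∈-image T {x} x∈T = ∈-image⁺ T (lookup x v) (subst (_∈ₛ T) (sym (ins-proj x)) x∈T)

  image-cong : ∀ {T U} → T ≐ U → image T ≐ image U
  image-cong T≐U y = cong₂ _∨_ (T≐U (ins y false)) (T≐U (ins y true))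

  twoStateAttractor-v⇒fixedPoint-proj : ∀ {T x} → IsTwoStateAttractor f v T → x ∈ₛ T → IsFixedPoint f̃ (proj v x)
  twoStateAttractor-v⇒fixedPoint-proj {T} {x} T-attr x∈T =
    proj₂ (onlyUnstableAt-v⁻ (both-values (lookup x v)
      (subst (OnlyUnstableAt f v) (sym (ins-proj x))
        (proj₁ (twoStateAttractor-onlyUnstableAt f T-attr x∈T)))
      (subst (OnlyUnstableAt f v) (trans (cong (flip v) (sym (ins-proj x))) (flip-ins _ _))
        (twoStateAttractor-onlyUnstableAt-flip f T-attr x∈T))))

  twoStateAttractor-image-flip : ∀ {j T y} → IsTwoStateAttractor f (punchIn v j) T → y ∈ₛ image T →
                                 flip j y ∈ₛ image T
  twoStateAttractor-image-flip {j} {T} {y} T-attr y∈T with ∈-image⁻ T y∈T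
  ... | c , ins∈T = ∈-image⁺ T c (subst (_∈ₛ T) (flip-punchIn-ins y c j)
                      (proj₂ (twoStateAttractor-onlyUnstableAt f T-attr ins∈T)))

  proj-≡-or-flip : ∀ {a b} → a ≡ b ⊎ a ≡ flip v b → proj v a ≡ proj v b
  proj-≡-or-flip (inj₁ refl) = refl
  proj-≡-or-flip {b = b} (inj₂ refl) = proj-flip b

  fᵥ-fixed-or-oscillates : ∀ y → (∃[ c ] fᵥ y c ≡ c) ⊎ Oscillates y
  fᵥ-fixed-or-oscillates y with fᵥ y false Boolₚ.≟ false | fᵥ y true Boolₚ.≟ true
  ... | yes fixed₀ | _         = inj₁ (false , fixed₀)
  ... | no _       | yes fixed₁ = inj₁ (true , fixed₁)
  ... | no moves₀  | no moves₁  = inj₂ (Boolₚ.¬-not moves₀ , Boolₚ.¬-not moves₁)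

  NonIncreasing : Set
  NonIncreasing = ∀ y → fᵥ y false ≡ false → fᵥ y true ≡ false

  ¬positiveLoop⇒nonIncreasing : ¬ PositiveLoop f v → NonIncreasing
  ¬positiveLoop⇒nonIncreasing ¬loop y fᵥ₀ with fᵥ y true in fᵥ₁
  ... | false = refl
  ... | true  = ⊥-elim (¬loop (ins y false , sign))
    where
    x : State (suc m)
    x = ins y false
    sign : signZ pos ≡ (b2z (comp f v (flip v x)) - b2z (comp f v x)) * (b2z (lookup (flip v x) v) - b2z (lookup x v))
    sign rewrite flip-ins y false | lookup-ins y true | lookup-ins y false | fᵥ₀ | fᵥ₁ = refl

  module _ (nonIncreasing : NonIncreasing) where

    fᵥ-constant : ∀ {y c} → fᵥ y c ≡ c → ∀ a → fᵥ y a ≡ c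
    fᵥ-constant {y} {false} fᵥ₀ = both-values false fᵥ₀ (nonIncreasing y fᵥ₀)
    fᵥ-constant {y} {true}  fᵥ₁ = both-values true fᵥ₁ (Boolₚ.¬-not (Boolₚ.not-¬ fᵥ₁ ∘ nonIncreasing y))

    S-constant : ∀ {y c} → fᵥ y c ≡ c → ∀ a → S f v a y ≡ ins y c
    S-constant {y} fixed a = cong (ins y) (fᵥ-constant fixed a)

    -- Where v is stable its slice is constant, so S⁰ and S¹ both return the state itself and the
    -- ∧/∨ defining f̃ collapses.
    stable-v⇒comp-f̃ : ∀ {x} → comp f v x ≡ lookup x v → ∀ k → comp f̃ k (proj v x) ≡ comp f (punchIn v k) x
    stable-v⇒comp-f̃ {x} stable-v k = begin
      comp f̃ k y
        ≡⟨ comp-f̃ y k ⟩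
      merge (lookup y k) (comp f (punchIn v k) (S f v false y)) (comp f (punchIn v k) (S f v true y))
        ≡⟨ cong₂ (merge (lookup y k)) (S-at false) (S-at true) ⟩
      merge (lookup y k) (comp f (punchIn v k) x) (comp f (punchIn v k) x)
        ≡⟨ merge-idem _ _ ⟩
      comp f (punchIn v k) x
        ∎
      where
      open ≡-Reasoning
      y : State m
      y = proj v x
      fᵥ-fixed : fᵥ y (lookup x v) ≡ lookup x v
      fᵥ-fixed = trans (cong (comp f v) (ins-proj x)) stable-v
      S-at : ∀ a → comp f (punchIn v k) (S f v a y) ≡ comp f (punchIn v k) x
      S-at a = cong (comp f (punchIn v k)) (trans (S-constant fᵥ-fixed a) (ins-proj x))

    fixedPoint-proj : ∀ {x} → IsFixedPoint f x → IsFixedPoint f̃ (proj v x)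
    fixedPoint-proj {x} fix = stable⇒fixedPoint f̃ λ k →
      trans (stable-v⇒comp-f̃ (stable v) k) (trans (stable (punchIn v k)) (sym (lookup-proj x k)))
      where
      stable : Stable f x
      stable = fixedPoint⇒stable f fix

    fixedPoint-ins : ∀ {y c} → fᵥ y c ≡ c → IsFixedPoint f̃ y → IsFixedPoint f (ins y c)
    fixedPoint-ins {y} {c} fᵥ-fixed fix = stable⇒fixedPoint f (punchIn-cases
      (trans fᵥ-fixed (sym (lookup-ins y c)))
      λ j → begin
        comp f (punchIn v j) (ins y c)         ≡⟨ cong (comp f (punchIn v j)) (S-constant fᵥ-fixed false) ⟨
        comp f (punchIn v j) (S f v false y)   ≡⟨ eliminate-stable⁻ (fixedPoint⇒stable f̃ fix j) false ⟩
        lookup y j                             ≡⟨ lookup-ins-punchIn y c j ⟨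
        lookup (ins y c) (punchIn v j)         ∎)
      where open ≡-Reasoning

    onlyUnstableAt-proj : ∀ {j x} → OnlyUnstableAt f (punchIn v j) x → OnlyUnstableAt f̃ j (proj v x)
    onlyUnstableAt-proj {j} {x} (stable , unstable) =
      (λ k k≢j → trans (comp-f̃≡ k) (trans (stable (punchIn v k) (k≢j ∘ Finₚ.punchIn-injective v k j))
                                           (sym (lookup-proj x k)))) ,
      λ stable-j → unstable (trans (sym (comp-f̃≡ j)) (trans stable-j (lookup-proj x j)))
      where
      comp-f̃≡ : ∀ k → comp f̃ k (proj v x) ≡ comp f (punchIn v k) x
      comp-f̃≡ = stable-v⇒comp-f̃ (stable v (Finₚ.punchInᵢ≢i v j ∘ sym))

    S-∈-trap : ∀ {T y c} → IsTrapSet f T → ins y c ∈ₛ T → ∀ a → S f v a y ∈ₛ T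
    S-∈-trap {T} {y} {c} T-trap ins∈T a with fᵥ y c Boolₚ.≟ c
    ... | yes fixed = subst (_∈ₛ T) (sym (S-constant fixed a)) ins∈T
    ... | no unstable = both-values {P = λ b → ins y b ∈ₛ T} c ins∈T flipped∈T (fᵥ y a)
      where
      flipped∈T : ins y (not c) ∈ₛ T
      flipped∈T = subst (_∈ₛ T) (flip-ins y c)
        (T-trap _ _ ins∈T (v , (λ fixed → unstable (trans fixed (lookup-ins y c))) , refl))

    image-trap : ∀ {T} → IsTrapSet f T → IsTrapSet f̃ (image T)
    image-trap {T} T-trap y _ y∈ (j , unstable , refl)
      with ∈-image⁻ T y∈ | eliminate-unstable unstable
    ... | c , ins∈T | a , unstable-a = ∈-image⁺ T (fᵥ y a) (subst (_∈ₛ T) (flip-punchIn-ins y (fᵥ y a) j)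
      (T-trap _ _ (S-∈-trap T-trap ins∈T a)
        (punchIn v j , (λ stable → unstable-a (trans stable (lookup-ins-punchIn y (fᵥ y a) j))) , refl)))

    -- Both attractors contain S⁰ y.
    attractors-sharing-image-≐ : ∀ {A B y} → IsAttractor f A → IsAttractor f B →
                                 y ∈ₛ image A → y ∈ₛ image B → A ≐ B
    attractors-sharing-image-≐ {A} {B} {y} A-attr B-attr y∈A y∈B =
      attractors-meeting-≐ f A-attr B-attr (S⁰∈ A-attr y∈A) (S⁰∈ B-attr y∈B)
      where
      S⁰∈ : ∀ {T} → IsAttractor f T → y ∈ₛ image T → S f v false y ∈ₛ T
      S⁰∈ {T} (_ , T-trap , _) y∈T = S-∈-trap T-trap (proj₂ (∈-image⁻ T y∈T)) false

    image-statesOf-unique : ∀ {t y y'} → FixedPointOrTwoState f v t →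
                            y ∈ₛ image (statesOf t) → y' ∈ₛ image (statesOf t) → y ≡ y'
    image-statesOf-unique {t} {y} {y'} Pt y∈ y'∈
      with ∈-image⁻ (statesOf t) y∈ | ∈-image⁻ (statesOf t) y'∈
    ... | c , ins∈ | c' , ins'∈ = begin
      y                  ≡⟨ proj-ins y c ⟨
      proj v (ins y c)   ≡⟨ proj-≡-or-flip (same-or-flipped Pt ins∈ ins'∈) ⟩
      proj v (ins y' c') ≡⟨ proj-ins y' c' ⟩
      y'                 ∎
      where
      open ≡-Reasoning
      same-or-flipped : ∀ {t a b} → FixedPointOrTwoState f v t → a ∈ₛ statesOf t → b ∈ₛ statesOf t →
                        a ≡ b ⊎ a ≡ flip v b
      same-or-flipped {inj₁ x} {a} {b} _ a∈ b∈ =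
        inj₁ (trans (∈-singleton⁻ {a = x} {a} a∈) (sym (∈-singleton⁻ {a = x} {b} b∈)))
      same-or-flipped {inj₂ T} (inj₂ T-attr) a∈ b∈ = twoStateAttractor-members f T-attr a∈ b∈

    fixedPoints-eliminate : ∀ {s s̃ a} → NumFixedPoints f s → NumFixedPoints f̃ s̃ →
                            NumTwoStateAttractors f v a → s̃ ≡ s + a
    fixedPoints-eliminate {s} {s̃} {a} hf hf̃ ht = ℕₚ.≤-antisym s̃≤ ≤s̃
      where
      attractor : ∀ {t} → FixedPointOrTwoState f v t → IsAttractor f (statesOf t)
      attractor = statesOf-attractor proj₁
      G : State (suc m) ⊎ StateSet (suc m) → State m → Set
      G t y = y ∈ₛ image (statesOf t)

      ≤s̃ : s + a ≤ s̃
      ≤s̃ = hasSize-≤ sym trans (hasSize-⊎ hf ht) hf̃ G total reflects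
        where
        total : ∀ t → FixedPointOrTwoState f v t → ∃[ y ] (IsFixedPoint f̃ y × G t y)
        total (inj₁ x) (inj₁ fix) = proj v x , fixedPoint-proj fix , proj-∈-image (singleton x) {x} (∈-singleton x)
        total (inj₂ T) (inj₂ T-attr@(((x , x∈T) , _) , _)) =
          proj v x , twoStateAttractor-v⇒fixedPoint-proj T-attr x∈T , proj-∈-image T x∈T
        reflects : ∀ {t t' y y'} → FixedPointOrTwoState f v t → FixedPointOrTwoState f v t' →
                   IsFixedPoint f̃ y → IsFixedPoint f̃ y' →
                   G t y → G t' y' → y ≡ y' → Pointwise _≡_ _≐_ t t'
        reflects Pt Pt' _ _ y∈ y'∈ refl = statesOf-injective (twoStateAttractor-nontrivial {g = f}) Pt Pt'
          (attractors-sharing-image-≐ (attractor Pt) (attractor Pt') y∈ y'∈)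

      s̃≤ : s̃ ≤ s + a
      s̃≤ = hasSize-≤ (⊎-symmetric sym ≐-sym) (⊎-transitive trans ≐-trans) hf̃ (hasSize-⊎ hf ht)
                     (λ y t → G t y) total reflects
        where
        total : ∀ y → IsFixedPoint f̃ y → ∃[ t ] (FixedPointOrTwoState f v t × G t y)
        total y fix with fᵥ-fixed-or-oscillates y
        ... | inj₁ (c , fixed) =
          inj₁ (ins y c) , inj₁ (fixedPoint-ins fixed fix) , ∈-image⁺ (singleton (ins y c)) c (∈-singleton (ins y c))
        ... | inj₂ osc =
          inj₂ (pair x (flip v x)) , inj₂ two-state , ∈-image⁺ (pair x (flip v x)) false (∈-pairˡ x (flip v x))
          where
          x : State (suc m)
          x = ins y false
          only : ∀ b → OnlyUnstableAt f v (ins y b)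
          only = onlyUnstableAt-v⁺ osc fix
          two-state : IsTwoStateAttractor f v (pair x (flip v x))
          two-state = onlyUnstableAt⇒twoStateAttractor f (only false)
                        (subst (OnlyUnstableAt f v) (sym (flip-ins y false)) (only true))
        reflects : ∀ {y y' t t'} → IsFixedPoint f̃ y → IsFixedPoint f̃ y' →
                   FixedPointOrTwoState f v t → FixedPointOrTwoState f v t' →
                   G t y → G t' y' → Pointwise _≡_ _≐_ t t' → y ≡ y'
        reflects {y' = y'} _ _ Pt _ y∈ y'∈ t≈t' = image-statesOf-unique Pt y∈
          (trans (image-cong (Pointwise⇒statesOf-≐ t≈t') y') y'∈)

    twoStateAttractors-eliminate-≤ : ∀ j {a ã} → NumTwoStateAttractors f (punchIn v j) a →
                                     NumTwoStateAttractors f̃ j ã → a ≤ ã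
    twoStateAttractors-eliminate-≤ j h h̃ = hasSize-≤ ≐-sym ≐-trans h h̃ G total reflects
      where
      G : StateSet (suc m) → StateSet m → Set
      G T U = ∃[ y ] (y ∈ₛ U × y ∈ₛ image T)

      total : ∀ T → IsTwoStateAttractor f (punchIn v j) T → ∃[ U ] (IsTwoStateAttractor f̃ j U × G T U)
      total T T-attr@(((x , x∈T) , _) , _) =
        pair y (flip j y) ,
        onlyUnstableAt⇒twoStateAttractor f̃
          (onlyUnstableAt-proj (proj₁ (twoStateAttractor-onlyUnstableAt f T-attr x∈T)))
          (subst (OnlyUnstableAt f̃ j) (proj-flip-punchIn j x)
            (onlyUnstableAt-proj (twoStateAttractor-onlyUnstableAt-flip f T-attr x∈T))) ,
        y , ∈-pairˡ y (flip j y) , proj-∈-image T x∈T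
        where
        y : State m
        y = proj v x

      reflects : ∀ {T T' U U'} → IsTwoStateAttractor f (punchIn v j) T → IsTwoStateAttractor f (punchIn v j) T' →
                 IsTwoStateAttractor f̃ j U → IsTwoStateAttractor f̃ j U' → G T U → G T' U' → U ≐ U' → T ≐ T'
      reflects {T} {T'} T-attr T'-attr _ U'-attr (y , y∈U , y∈T) (y' , y'∈U' , y'∈T') U≐U' =
        attractors-sharing-image-≐ (proj₁ T-attr) (proj₁ T'-attr) y∈T y∈T'
        where
        y∈T' : y ∈ₛ image T'
        y∈T' with twoStateAttractor-members f̃ U'-attr (trans (sym (U≐U' y)) y∈U) y'∈U'
        ... | inj₁ refl = y'∈T'
        ... | inj₂ refl = twoStateAttractor-image-flip T'-attr y'∈T'

    fixedPoints+cyclicAttractors-eliminate-≤ : ∀ {s a s̃ ã} → NumFixedPoints f s → NumCyclicAttractors f a →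
                                               NumFixedPoints f̃ s̃ → NumCyclicAttractors f̃ ã → s + a ≤ s̃ + ã
    fixedPoints+cyclicAttractors-eliminate-≤ hf hc hf̃ hc̃ =
      hasSize-≤ (⊎-symmetric sym ≐-sym) (⊎-transitive trans ≐-trans) (hasSize-⊎ hf hc) (hasSize-⊎ hf̃ hc̃)
                G total reflects
      where
      G : State (suc m) ⊎ StateSet (suc m) → State m ⊎ StateSet m → Set
      G t u = statesOf u ⊆ₛ image (statesOf t)

      total : ∀ t → FixedPointOrCyclic f t →
              ∃[ u ] (FixedPointOrCyclic f̃ u × G t u)
      total t Pt with statesOf-attractor proj₁ Pt
      ... | ((x , x∈A) , A-trap , _)
        with Reachability.attractor-in-trap f̃ (proj v x , proj-∈-image (statesOf t) x∈A) (image-trap A-trap)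
      ... | B , B-attr , B⊆ with Reachability.attractor-fixedPoint-or-cyclic f̃ B-attr
      ... | inj₁ (y , fix , y∈B) = inj₁ y , inj₁ fix , λ z z∈ → B⊆ z (singleton-⊆ y∈B z z∈)
      ... | inj₂ cyclic = inj₂ B , inj₂ cyclic , B⊆

      reflects : ∀ {t t' u u'} →
                 FixedPointOrCyclic f t → FixedPointOrCyclic f t' →
                 FixedPointOrCyclic f̃ u → FixedPointOrCyclic f̃ u' →
                 G t u → G t' u' → Pointwise _≡_ _≐_ u u' → Pointwise _≡_ _≐_ t t'
      reflects {u = u} Pt Pt' Qu _ u⊆ u'⊆ u≈u' with statesOf-attractor proj₁ Qu
      ... | ((y , y∈u) , _) = statesOf-injective proj₂ Pt Pt' (attractors-sharing-image-≐
        (statesOf-attractor proj₁ Pt) (statesOf-attractor proj₁ Pt')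
        (u⊆ y y∈u) (u'⊆ y (trans (sym (Pointwise⇒statesOf-≐ u≈u' y)) y∈u)))

corollary3p4 : ∀ {m} (f : BN (suc m)) (v : Fin (suc m)) →
    ¬ PositiveLoop f v →
    -- (i)  S(f̃) = S(f) + A(f,v), hence S(f) ≤ S(f̃)
    (∀ s s̃ a → NumFixedPoints f s → NumFixedPoints (eliminate f v) s̃ →
       NumTwoStateAttractors f v a → (s̃ ≡ s + a) × (s ≤ s̃))
    -- (ii) A(f,i) ≤ A(f̃,i) for all i ∈ V ∖ {v}
    × (∀ (j : Fin m) a ã → NumTwoStateAttractors f (punchIn v j) a →
         NumTwoStateAttractors (eliminate f v) j ã → a ≤ ã)
    -- (iii) S(f) + A(f) ≤ S(f̃) + A(f̃)
    × (∀ s a s̃ ã → NumFixedPoints f s → NumCyclicAttractors f a →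
         NumFixedPoints (eliminate f v) s̃ → NumCyclicAttractors (eliminate f v) ã →
         s + a ≤ s̃ + ã)
corollary3p4 f v ¬loop =
  (λ s s̃ a hf hf̃ ht → let s̃≡s+a = fixedPoints-eliminate nonIncreasing hf hf̃ ht in
     s̃≡s+a , subst (s ≤_) (sym s̃≡s+a) (ℕₚ.m≤m+n s a)) ,
  (λ j _ _ → twoStateAttractors-eliminate-≤ nonIncreasing j) ,
  (λ _ _ _ _ → fixedPoints+cyclicAttractors-eliminate-≤ nonIncreasing)
  where
  open Elimination f v
  nonIncreasing : NonIncreasing
  nonIncreasing = ¬positiveLoop⇒nonIncreasing ¬loop
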